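{- Let $H$ be a bush graph and let $v$ be a vertex of $H$ that is the center of the bush of largest weight of $H$ (so every edge of maximum weight in $H$ is incident to $v$). If the edge $(u,v)$ belongs to some maximum weight greedy matching of $H$, then $\mathrm{OPT}(H)=w(u,v)+\mathrm{OPT}(H-\{u,v\})$.
   Context: Graphs are finite, simple, undirected, with positive edge weights; the weight of a matching is the sum of its edge weights. With distinct edge weights $w_1>\dots>w_\ell$, a greedy matching is any matching that can be output by: $\mathcal{M}\leftarrow\emptyset$; for $i=1,\dots,\ell$, while the current edge set contains an edge of weight $w_i$, pick any such edge $e^*$, add it to $\mathcal{M}$ and delete all edges sharing an endpoint with $e^*$. $\mathrm{OPT}(G)$ is the maximum weight of a greedy matching of $G$ (equal to 0 if $G$ has no edges). $H-S$ denotes the subgraph induced by $V(H)\setminus S$. $H$ is a bush graph if for every distinct weight $w_i$ the edges of weight $w_i$ form a star (all share a common vertex, its center); this star is the $i$-th bush.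
   Formalization: The edge weights of H take values in the positive rationals. -}

module Defs where

open import Data.Nat using (ℕ)
open import Data.Fin using (Fin; _≟_)
open import Data.Bool using (Bool; true; false; _∧_; _∨_; not)
open import Data.Rational using (ℚ; 0ℚ; _+_; _<_; _≤_; _>_)
open import Data.List using (List; []; _∷_; _++_)
open import Data.List.Membership.Propositional using (_∈_)
open import Data.List.Relation.Unary.Linked using (Linked)
open import Data.Product using (_×_; _,_; ∃; ∃-syntax; Σ)
open import Data.Sum using (_⊎_)
open import Function.Bundles using (_⇔_)
open import Relation.Nullary using (¬_)
open import Relation.Nullary.Decidable using (⌊_⌋)
open import Relation.Binary.PropositionalEquality using (_≡_; _≢_)

record WGraph (n : ℕ) : Set where
  field
    adj     : Fin n → Fin n → Bool
    w       : Fin n → Fin n → ℚ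
    adj-sym : ∀ x y → adj x y ≡ adj y x
    w-sym   : ∀ x y → w x y ≡ w y x
    irrefl  : ∀ x → adj x x ≡ false
    w-pos   : ∀ x y → adj x y ≡ true → 0ℚ < w x y
open WGraph public

Edge : ℕ → Set
Edge n = Fin n × Fin n

-- Deleted vertices are kept as isolated vertices (all their edges are
-- removed); isolated vertices are irrelevant for matchings.
_─_ : ∀ {n} → WGraph n → (Fin n → Bool) → WGraph n
_─_ {n} G S = record
  { adj     = λ x y → adj G x y ∧ not (S x) ∧ not (S y)
  ; w       = w G
  ; adj-sym = sym'
  ; w-sym   = w-sym G
  ; irrefl  = irr
  ; w-pos   = pos
  }
  where
  open import Relation.Binary.PropositionalEquality using (refl; cong; trans)
  open import Data.Bool.Properties using (∧-comm; ∧-assoc)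
  sym' : ∀ x y → (adj G x y ∧ not (S x) ∧ not (S y)) ≡ (adj G y x ∧ not (S y) ∧ not (S x))
  sym' x y rewrite adj-sym G x y with adj G y x | S x | S y
  ... | false | _ | _ = refl
  ... | true | true | true = refl
  ... | true | true | false = refl
  ... | true | false | true = refl
  ... | true | false | false = refl
  irr : ∀ x → (adj G x x ∧ not (S x) ∧ not (S x)) ≡ false
  irr x rewrite irrefl G x = refl
  pos : ∀ x y → (adj G x y ∧ not (S x) ∧ not (S y)) ≡ true → 0ℚ < w G x y
  pos x y h with adj G x y in eq
  ... | true = w-pos G x y eq
  pos x y () | false

pair : ∀ {n} → Fin n → Fin n → Fin n → Bool
pair a b x = ⌊ x ≟ a ⌋ ∨ ⌊ x ≟ b ⌋

HasEdgeOfWeight : ∀ {n} → WGraph n → ℚ → Set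
HasEdgeOfWeight G c = ∃[ x ] ∃[ y ] (adj G x y ≡ true × w G x y ≡ c)

-- One iteration i of the greedy algorithm for weight c = w_i:
-- Phase c G M G' : starting from the current graph G, the while-loop for
-- weight c can pick the edges M (in order) and end with the graph G'.
-- Picking e* = (a,b) and deleting all edges sharing an endpoint with e*
-- is G ─ pair a b.
data Phase {n : ℕ} (c : ℚ) : WGraph n → List (Edge n) → WGraph n → Set where
  done : ∀ {G} → ¬ HasEdgeOfWeight G c → Phase c G [] G
  step : ∀ {G M G'} a b → adj G a b ≡ true → w G a b ≡ c →
         Phase c (G ─ pair a b) M G' → Phase c G ((a , b) ∷ M) G'

-- The for-loop over the weights w_1 > ... > w_ℓ (given as a list).
data Run {n : ℕ} : List ℚ → WGraph n → List (Edge n) → Set where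
  []  : ∀ {G} → Run [] G []
  _∷_ : ∀ {c ws G M G' M'} → Phase c G M G' → Run ws G' M' →
        Run (c ∷ ws) G (M ++ M')

DistinctWeightsDesc : ∀ {n} → WGraph n → List ℚ → Set
DistinctWeightsDesc G ws = Linked _>_ ws × (∀ c → (c ∈ ws) ⇔ HasEdgeOfWeight G c)

Greedy : ∀ {n} → WGraph n → List (Edge n) → Set
Greedy G M = ∃[ ws ] (DistinctWeightsDesc G ws × Run ws G M)

weight : ∀ {n} → WGraph n → List (Edge n) → ℚ
weight G [] = 0ℚ
weight G ((a , b) ∷ M) = w G a b + weight G M

MaxGreedy : ∀ {n} → WGraph n → List (Edge n) → Set
MaxGreedy G M = Greedy G M × (∀ M' → Greedy G M' → weight G M' ≤ weight G M)

-- IsOPT G o : o = OPT(G), the maximum weight of a greedy matching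
-- (this is 0 when G has no edges, as the only greedy matching is then []).
IsOPT : ∀ {n} → WGraph n → ℚ → Set
IsOPT G o = (∃[ M ] (Greedy G M × weight G M ≡ o)) ×
            (∀ M → Greedy G M → weight G M ≤ o)

IsBush : ∀ {n} → WGraph n → Set
IsBush {n} G = ∀ c → HasEdgeOfWeight G c →
  ∃[ z ] (∀ x y → adj G x y ≡ true → w G x y ≡ c → x ≡ z ⊎ y ≡ z)

CenterOfLargest : ∀ {n} → WGraph n → Fin n → Set
CenterOfLargest G v = ∀ x y → adj G x y ≡ true →
  (∀ x' y' → adj G x' y' ≡ true → w G x' y' ≤ w G x y) → x ≡ v ⊎ y ≡ v

EdgeIn : ∀ {n} → Fin n → Fin n → List (Edge n) → Set
EdgeIn u v M = (u , v) ∈ M ⊎ (v , u) ∈ M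

module Submission where

-- Let c be the largest edge weight of H.  Every edge of weight
-- c touches v, so the first greedy phase picks exactly one edge e at v and
-- afterwards no edge of weight c survives; the rest of the run is a greedy
-- run of H - e.  If {u,v} lies in the maximum greedy matching M, then e is
-- {u,v}: later picks avoid v.  Hence
--   * every greedy matching M₂ of H - {u,v} extends to the greedy matching
--     (u,v) ∷ M₂ of H, giving OPT(H) ≥ w(u,v) + OPT(H - {u,v}), and
--   * M itself is (u,v) followed by a greedy matching of H - {u,v}, giving
--     OPT(H) = weight M ≤ w(u,v) + OPT(H - {u,v}).

open import Defs
open import Data.Nat using (ℕ)
open import Data.Fin using (Fin)
open import Data.Rational using (ℚ; _+_)
open import Data.Product using (∃-syntax; _×_)

open import Data.Fin as F using ()
open import Data.Fin.Properties using (any?)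
open import Data.Bool using (true; false; _∧_; not)
open import Data.Bool.Properties using (∨-comm) renaming (_≟_ to _≟B_)
open import Data.Rational using (_<_; _≤_; _>_)
open import Data.Rational.Properties as ℚP using ()
open import Data.List using (List; []; _∷_)
open import Data.List.Membership.Propositional using (_∈_)
open import Data.List.Relation.Unary.Any using (here; there)
open import Data.List.Relation.Unary.Any.Properties using (¬Any[])
import Data.List.Relation.Unary.All as All
import Data.List.Relation.Unary.AllPairs as AllPairs
open import Data.List.Relation.Unary.Linked using (Linked; tail)
open import Data.List.Relation.Unary.Linked.Properties using (Linked⇒AllPairs)
open import Data.Product using (_,_; proj₁; proj₂)
open import Data.Sum using (_⊎_; inj₁; inj₂)
open import Data.Empty using (⊥-elim)
open import Function.Bundles using (_⇔_; Equivalence)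
open import Relation.Nullary using (¬_; Dec; yes; no)
open import Relation.Nullary.Decidable using (⌊_⌋; _×-dec_)
open import Relation.Binary.PropositionalEquality

belowHead : ∀ {c d r} → Linked _>_ (c ∷ r) → d ∈ r → d < c
belowHead desc = All.lookup (AllPairs.head (Linked⇒AllPairs >-trans desc))
  where
  >-trans : ∀ {x y z} → x > y → y > z → x > z
  >-trans y<x z<y = ℚP.<-trans z<y y<x

atMostHead : ∀ {c d r} → Linked _>_ (c ∷ r) → d ∈ (c ∷ r) → d ≤ c
atMostHead desc (here refl) = ℚP.≤-refl
atMostHead desc (there d∈r) = ℚP.<⇒≤ (belowHead desc d∈r)

Covers : ∀ {n} → WGraph n → List ℚ → Set
Covers G ws = ∀ c → HasEdgeOfWeight G c → c ∈ ws

hasEdge? : ∀ {n} (G : WGraph n) c → Dec (HasEdgeOfWeight G c)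
hasEdge? G c = any? λ x → any? λ y → (adj G x y ≟B true) ×-dec (w G x y ℚP.≟ c)

adj─ : ∀ {n} (G : WGraph n) S x y → adj (G ─ S) x y ≡ true →
       adj G x y ≡ true × S x ≡ false × S y ≡ false
adj─ G S x y e = split (adj G x y) (S x) (S y) e
  where
  split : ∀ a b c → (a ∧ not b ∧ not c) ≡ true → a ≡ true × b ≡ false × c ≡ false
  split true false false _ = refl , refl , refl
  split true false true ()
  split true true _ ()
  split false _ _ ()

pairDeletes : ∀ {n} {a b z : Fin n} → a ≡ z ⊎ b ≡ z → pair a b z ≡ true
pairDeletes {a = a} (inj₁ refl) with a F.≟ a
... | yes _ = refl
... | no a≢a = ⊥-elim (a≢a refl)
pairDeletes {a = a} {b} (inj₂ refl) with b F.≟ a | b F.≟ b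
... | yes _ | _ = refl
... | no _ | yes _ = refl
... | no _ | no b≢b = ⊥-elim (b≢b refl)

notKept : ∀ {n} {a b z : Fin n} → a ≡ z ⊎ b ≡ z → ¬ pair a b z ≡ false
notKept at-z kept with trans (sym (pairDeletes at-z)) kept
... | ()

weight─ : ∀ {n} (G : WGraph n) S M → weight (G ─ S) M ≡ weight G M
weight─ G S [] = refl
weight─ G S ((a , b) ∷ M) = cong (w G a b +_) (weight─ G S M)

record Sub {n} (G' G : WGraph n) : Set where
  field
    sub-adj : ∀ x y → adj G' x y ≡ true → adj G x y ≡ true
    sub-w   : ∀ x y → w G' x y ≡ w G x y
open Sub

sub-refl : ∀ {n} {G : WGraph n} → Sub G G
sub-refl = record { sub-adj = λ _ _ e → e ; sub-w = λ _ _ → refl }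

sub-trans : ∀ {n} {G₁ G₂ G₃ : WGraph n} → Sub G₁ G₂ → Sub G₂ G₃ → Sub G₁ G₃
sub-trans s t = record { sub-adj = λ x y e → sub-adj t x y (sub-adj s x y e)
                       ; sub-w   = λ x y → trans (sub-w s x y) (sub-w t x y) }

sub─ : ∀ {n} (G : WGraph n) S → Sub (G ─ S) G
sub─ G S = record { sub-adj = λ x y e → proj₁ (adj─ G S x y e) ; sub-w = λ _ _ → refl }

subHas : ∀ {n} {G' G : WGraph n} {c} → Sub G' G → HasEdgeOfWeight G' c → HasEdgeOfWeight G c
subHas s (x , y , e , wc) = x , y , sub-adj s x y e , trans (sym (sub-w s x y)) wc

phaseSub : ∀ {n c} {G G' : WGraph n} {M} → Phase c G M G' → Sub G' G
phaseSub (done _) = sub-refl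
phaseSub {G = G} (step a b _ _ p) = sub-trans (phaseSub p) (sub─ G (pair a b))

phaseEnd : ∀ {n c} {G G' : WGraph n} {M} → Phase c G M G' → ¬ HasEdgeOfWeight G' c
phaseEnd (done none) = none
phaseEnd (step _ _ _ _ p) = phaseEnd p

runEdges : ∀ {n ws} {G : WGraph n} {M x y} → Run ws G M → (x , y) ∈ M → adj G x y ≡ true
runEdges (done _ ∷ run) xy∈M = runEdges run xy∈M
runEdges (step a b ab _ p ∷ run) (here refl) = ab
runEdges {G = G} (step a b _ _ p ∷ run) (there xy∈M) =
  sub-adj (sub─ G (pair a b)) _ _ (runEdges (p ∷ run) xy∈M)

coversTail : ∀ {n} {G' G : WGraph n} {c ws} → Covers G (c ∷ ws) → Sub G' G →
             ¬ HasEdgeOfWeight G' c → Covers G' ws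
coversTail cov s none d h with cov d (subHas s h)
... | here refl = ⊥-elim (none h)
... | there d∈ws = d∈ws

-- G and G' have the same edges and weights.  Runs transport along this
-- relation; it is needed because G ─ pair a b and G ─ pair b a are not
-- definitionally equal.
record SameGraph {n} (G G' : WGraph n) : Set where
  field
    same-adj : ∀ x y → adj G x y ≡ adj G' x y
    same-w   : ∀ x y → w G x y ≡ w G' x y
open SameGraph

sameDelete : ∀ {n} {G G' : WGraph n} → SameGraph G G' → ∀ S S' → (∀ x → S x ≡ S' x) →
             SameGraph (G ─ S) (G' ─ S')
sameDelete eq S S' S≗S' = record
  { same-adj = λ x y → cong₂ _∧_ (same-adj eq x y)
                                 (cong₂ (λ p q → not p ∧ not q) (S≗S' x) (S≗S' y))
  ; same-w = same-w eq }

sameHas : ∀ {n} {G G' : WGraph n} {c} → SameGraph G G' → HasEdgeOfWeight G' c → HasEdgeOfWeight G c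
sameHas eq (x , y , e , wc) = x , y , trans (same-adj eq x y) e , trans (same-w eq x y) wc

phaseCong : ∀ {n c} {G G₁ G' : WGraph n} {M} → Phase c G M G₁ → SameGraph G G' →
            ∃[ G₁' ] (Phase c G' M G₁' × SameGraph G₁ G₁')
phaseCong {G' = G'} (done none) eq = G' , done (λ h → none (sameHas eq h)) , eq
phaseCong (step a b ab wc p) eq with phaseCong p (sameDelete eq (pair a b) (pair a b) λ _ → refl)
... | G₁' , p' , eq' =
  G₁' , step a b (trans (sym (same-adj eq a b)) ab) (trans (sym (same-w eq a b)) wc) p' , eq'

runCong : ∀ {n ws} {G G' : WGraph n} {M} → Run ws G M → SameGraph G G' → Run ws G' M
runCong [] eq = []
runCong (p ∷ run) eq with phaseCong p eq
... | _ , p' , eq' = p' ∷ runCong run eq'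

runSwap : ∀ {n ws} {G : WGraph n} {a b M} → Run ws (G ─ pair a b) M → Run ws (G ─ pair b a) M
runSwap {G = G} {a} {b} run = runCong run (sameDelete sameRefl (pair a b) (pair b a)
                                             λ x → ∨-comm ⌊ x F.≟ a ⌋ ⌊ x F.≟ b ⌋)
  where
  sameRefl : SameGraph G G
  sameRefl = record { same-adj = λ _ _ → refl ; same-w = λ _ _ → refl }

emptyRun : ∀ {n} ws (G : WGraph n) → (∀ c → ¬ HasEdgeOfWeight G c) → Run ws G []
emptyRun [] G none = []
emptyRun (c ∷ ws) G none = done (none c) ∷ emptyRun ws G none

-- Weights absent from G give empty phases; the first weight with a non-empty
-- phase must be the maximum of G's weights in both lists.
reindex : ∀ {n} ws₁ ws₂ {G : WGraph n} {M} → Linked _>_ ws₁ → Linked _>_ ws₂ →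
          Covers G ws₁ → Covers G ws₂ → Run ws₁ G M → Run ws₂ G M
reindex [] ws₂ {G} _ _ cov₁ _ [] = emptyRun ws₂ G λ c h → ¬Any[] (cov₁ c h)
reindex (c ∷ ws₁) ws₂ {G} desc₁ desc₂ cov₁ cov₂ (done none ∷ run) =
  reindex ws₁ ws₂ (tail desc₁) desc₂ (coversTail cov₁ (sub-refl {G = G}) none) cov₂ run
reindex (c ∷ ws₁) [] _ _ _ cov₂ (step a b ab wc _ ∷ _) with cov₂ c (a , b , ab , wc)
... | ()
reindex (c ∷ ws₁) (d ∷ ws₂) {G} desc₁ desc₂ cov₁ cov₂ run@(phase@(step a b ab wc _) ∷ rest)
  with hasEdge? G d
... | no none = done none ∷ reindex (c ∷ ws₁) ws₂ desc₁ (tail desc₂) cov₁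
                                    (coversTail cov₂ (sub-refl {G = G}) none) run
... | yes has with ℚP.≤-antisym (atMostHead desc₂ (cov₂ c (a , b , ab , wc)))
                                (atMostHead desc₁ (cov₁ d has))
...   | refl = phase ∷ reindex ws₁ ws₂ (tail desc₁) (tail desc₂)
                         (coversTail cov₁ (phaseSub phase) (phaseEnd phase))
                         (coversTail cov₂ (phaseSub phase) (phaseEnd phase)) rest

module TopWeight {n} (H : WGraph n) (v : Fin n) (centre : CenterOfLargest H v)
                 (c : ℚ) (r : List ℚ) (desc : Linked _>_ (c ∷ r))
                 (complete : ∀ d → (d ∈ (c ∷ r)) ⇔ HasEdgeOfWeight H d) where

  covers : Covers H (c ∷ r)
  covers d = Equivalence.from (complete d)

  -- c is the maximum weight, so every edge of weight c touches v.
  topIsMax : ∀ x y → adj H x y ≡ true → w H x y ≤ c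
  topIsMax x y e = atMostHead desc (covers (w H x y) (x , y , e , refl))

  topAtCentre : ∀ x y → adj H x y ≡ true → w H x y ≡ c → x ≡ v ⊎ y ≡ v
  topAtCentre x y e wc = centre x y e λ x' y' e' → subst (w H x' y' ≤_) (sym wc) (topIsMax x' y' e')

  noTopAfter : ∀ {a b} → a ≡ v ⊎ b ≡ v → ¬ HasEdgeOfWeight (H ─ pair a b) c
  noTopAfter {a} {b} at-v (x , y , e , wc) with adj─ H (pair a b) x y e
  ... | e' , x-kept , y-kept with topAtCentre x y e' wc
  ...   | inj₁ refl = notKept at-v x-kept
  ...   | inj₂ refl = notKept at-v y-kept

  coversAfter : ∀ {a b} → a ≡ v ⊎ b ≡ v → Covers (H ─ pair a b) r
  coversAfter {a} {b} at-v = coversTail covers (sub─ H (pair a b)) (noTopAfter at-v)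

  data FirstPick : List (Edge n) → Set where
    pick : ∀ a b {M} → adj H a b ≡ true → w H a b ≡ c → Run r (H ─ pair a b) M →
           FirstPick ((a , b) ∷ M)

  firstPick : ∀ {M} → Run (c ∷ r) H M → FirstPick M
  firstPick (done none ∷ _) = ⊥-elim (none (Equivalence.to (complete c) (here refl)))
  firstPick (step a b ab wc (done _) ∷ rest) = pick a b ab wc rest
  firstPick (step a b ab wc (step a' b' ab' wc' _) ∷ _) =
    ⊥-elim (noTopAfter (topAtCentre a b ab wc) (a' , b' , ab' , wc'))

  extend : ∀ {u M₂} → adj H u v ≡ true → w H u v ≡ c → Greedy (H ─ pair u v) M₂ →
           Greedy H ((u , v) ∷ M₂)
  extend uv wc (ws₂ , (desc₂ , complete₂) , run₂) =
    c ∷ r , (desc , complete) ,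
    step _ v uv wc (done (noTopAfter (inj₂ refl)))
      ∷ reindex ws₂ r desc₂ (tail desc) (λ d → Equivalence.from (complete₂ d))
                (coversAfter (inj₂ refl)) run₂

  restrict : ∀ {u ws₂ M₁} → DistinctWeightsDesc (H ─ pair u v) ws₂ → Run r (H ─ pair u v) M₁ →
             Greedy (H ─ pair u v) M₁
  restrict {ws₂ = ws₂} (desc₂ , complete₂) run =
    ws₂ , (desc₂ , complete₂) ,
    reindex r ws₂ (tail desc) desc₂ (coversAfter (inj₂ refl))
            (λ d → Equivalence.from (complete₂ d)) run

  laterAvoidCentre : ∀ {a b M x} → a ≡ v ⊎ b ≡ v → Run r (H ─ pair a b) M → ¬ EdgeIn x v M
  laterAvoidCentre {a} {b} {x = x} at-v run (inj₁ xv∈M) =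
    notKept at-v (proj₂ (proj₂ (adj─ H (pair a b) x v (runEdges run xv∈M))))
  laterAvoidCentre {a} {b} {x = x} at-v run (inj₂ vx∈M) =
    notKept at-v (proj₁ (proj₂ (adj─ H (pair a b) v x (runEdges run vx∈M))))

  record StartsWithUV (u : Fin n) (M : List (Edge n)) : Set where
    field
      rest     : List (Edge n)
      uv-edge  : adj H u v ≡ true
      uv-top   : w H u v ≡ c
      rest-run : Run r (H ─ pair u v) rest
      split    : weight H M ≡ w H u v + weight H rest

  startsWithUV : ∀ {u M} → FirstPick M → EdgeIn u v M → StartsWithUV u M
  startsWithUV (pick a b {M₁} ab wc rest) (inj₁ (here refl)) = record
    { rest = M₁ ; uv-edge = ab ; uv-top = wc ; rest-run = rest ; split = refl }
  startsWithUV (pick a b {M₁} ab wc rest) (inj₂ (here refl)) = record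
    { rest = M₁ ; uv-edge = trans (adj-sym H b a) ab ; uv-top = trans (w-sym H b a) wc
    ; rest-run = runSwap {G = H} {a} {b} rest ; split = cong (_+ weight H M₁) (w-sym H a b) }
  startsWithUV (pick a b ab wc rest) (inj₁ (there uv∈rest)) =
    ⊥-elim (laterAvoidCentre (topAtCentre a b ab wc) rest (inj₁ uv∈rest))
  startsWithUV (pick a b ab wc rest) (inj₂ (there vu∈rest)) =
    ⊥-elim (laterAvoidCentre (topAtCentre a b ab wc) rest (inj₂ vu∈rest))

lemma5 : ∀ {n} (H : WGraph n) (u v : Fin n) → IsBush H → CenterOfLargest H v →
    (∃[ M ] (MaxGreedy H M × EdgeIn u v M)) →
    ∀ (o : ℚ) → IsOPT (H ─ pair u v) o → IsOPT H (w H u v + o)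
lemma5 H u v _ _ (_ , (([] , _ , []) , _) , inj₁ ())
lemma5 H u v _ _ (_ , (([] , _ , []) , _) , inj₂ ())
lemma5 H u v _ centre (M , ((c ∷ r , (desc , complete) , run) , maxM) , uv∈M) o
       ((M₂ , greedy₂@(_ , weights₂ , _) , M₂≡o) , optBound) =
  ((u , v) ∷ M₂ , extend uv-edge uv-top greedy₂ , lower) ,
  λ M' greedy' → ℚP.≤-trans (maxM M' greedy') upper
  where
  open TopWeight H v centre c r desc complete
  open StartsWithUV (startsWithUV (firstPick run) uv∈M)
  open ℚP.≤-Reasoning

  lower : weight H ((u , v) ∷ M₂) ≡ w H u v + o
  lower = cong (w H u v +_) (trans (sym (weight─ H (pair u v) M₂)) M₂≡o)

  upper : weight H M ≤ w H u v + o
  upper = begin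
    weight H M                             ≡⟨ split ⟩
    w H u v + weight H rest                ≡⟨ cong (w H u v +_) (sym (weight─ H (pair u v) rest)) ⟩
    w H u v + weight (H ─ pair u v) rest   ≤⟨ ℚP.+-monoʳ-≤ (w H u v) (optBound rest (restrict weights₂ rest-run)) ⟩
    w H u v + o                            ∎
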